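{- Let $m\ge 2$ be an integer and $k=5m+1$. Then $va_3^{\equiv}(K_{4k+1,4k+1,4k+1})\leq 12m$.
   Context: All graphs are finite and simple. A $t$-coloring of a graph $G$ is a map $f:V(G)\to\{1,\dots,t\}$, with color classes $V_i=\{v: f(v)=i\}$. It is equitable if $\big||V_i|-|V_j|\big|\le 1$ for all $i,j$. A $(t,k)$-tree-coloring of $G$ is a $t$-coloring such that every connected component of each induced subgraph $G[V_i]$ is a tree of maximum degree at most $k$; an equitable $(t,k)$-tree-coloring is a $(t,k)$-tree-coloring that is equitable. The strong equitable vertex $k$-arboricity $va_k^{\equiv}(G)$ is the smallest integer $t$ such that $G$ has an equitable $(t',k)$-tree-coloring for every integer $t'\ge t$. $K_{n,n,n}$ denotes the complete tripartite graph whose three partite sets each have exactly $n$ vertices. -}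

module Defs where

open import Data.Nat using (ℕ; suc; _+_; _*_; _≤_)
open import Data.Fin using (Fin; quotient)
open import Data.Fin.Properties using (_≟_)
open import Data.List using (List; []; _∷_; _++_; [_]; length; filter; allFin)
open import Data.List.Relation.Unary.All using (All)
open import Data.List.Relation.Unary.Unique.Propositional using (Unique)
open import Data.List.Relation.Unary.Linked using (Linked)
open import Data.Product using (Σ; _×_; ∃)
open import Relation.Nullary using (¬_; Dec)
open import Relation.Nullary.Decidable using (¬?; _×-dec_)
open import Relation.Binary.PropositionalEquality using (_≡_)
open import Relation.Binary using (Decidable)

record Graph : Set₁ where
  field
    N      : ℕ
    _~_    : Fin N → Fin N → Set
    _~?_   : Decidable _~_
    sym    : ∀ {u v} → u ~ v → v ~ u
    irrefl : ∀ {v} → ¬ (v ~ v)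

-- Complete tripartite graph K_{n,n,n}: vertex v ∈ Fin (3 * n) lies in part
-- quotient n v ∈ Fin 3; two vertices are adjacent iff their parts differ.
part : (n : ℕ) → Fin (3 * n) → Fin 3
part n v = quotient {3} n v

K3 : ℕ → Graph
K3 n = record
  { N      = 3 * n
  ; _~_    = λ u v → ¬ (part n u ≡ part n v)
  ; _~?_   = λ u v → ¬? (part n u ≟ part n v)
  ; sym    = λ p q → p (Relation.Binary.PropositionalEquality.sym q)
  ; irrefl = λ p → p Relation.Binary.PropositionalEquality.refl
  }

module _ (G : Graph) where
  open Graph G

  Coloring : ℕ → Set
  Coloring t = Fin N → Fin t

  classSize : ∀ {t} → Coloring t → Fin t → ℕ
  classSize f i = length (filter (λ v → f v ≟ i) (allFin N))

  Equitable : ∀ {t} → Coloring t → Set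
  Equitable {t} f = ∀ (i j : Fin t) → classSize f i ≤ classSize f j + 1

  classDegree : ∀ {t} → Coloring t → Fin N → ℕ
  classDegree f v = length (filter (λ u → (u ~? v) ×-dec (f u ≟ f v)) (allFin N))

  HasCycleIn : ∀ {t} → Coloring t → Fin t → Set
  HasCycleIn f i = Σ (Fin N) λ v → Σ (List (Fin N)) λ ws →
    2 ≤ length ws × Unique (v ∷ ws) × All (λ u → f u ≡ i) (v ∷ ws)
      × Linked _~_ (v ∷ ws ++ [ v ])

  -- (t,k)-tree-coloring: every component of each G[V_i] is a tree
  -- (i.e. G[V_i] has no cycle) of maximum degree at most k.
  TreeColoring : ∀ t → ℕ → Coloring t → Set
  TreeColoring t k f =
    (∀ (i : Fin t) → ¬ HasCycleIn f i) × (∀ (v : Fin N) → classDegree f v ≤ k)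

  EquitableTreeColoring : ∀ t → ℕ → Coloring t → Set
  EquitableTreeColoring t k f = TreeColoring t k f × Equitable f

  -- va_k^≡(G) ≤ T : since va_k^≡(G) is the least t such that G has an
  -- equitable (t',k)-tree-coloring for all t' ≥ t, this holds iff G has an
  -- equitable (t',k)-tree-coloring for every t' ≥ T.
  StrongEqVertexArboricity≤ : ℕ → ℕ → Set
  StrongEqVertexArboricity≤ k T =
    ∀ (t' : ℕ) → T ≤ t' → Σ (Coloring t') (EquitableTreeColoring t' k)

-- Number the vertices of K_{n,n,n}, n = 20m + 5, part after part, and color them by cutting this
-- sequence into t consecutive blocks whose sizes differ by at most one. A block inside one part is
-- independent, and a block of at most four vertices all but one of which lie in one part induces a
-- star with at most three leaves. For 12m ≤ t ≤ 15m + 3 (block sizes 4 to 6) every part can be cut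
-- into whole blocks; for 15m + 4 ≤ t ≤ n (sizes 3 and 4) it suffices that the cuts miss the part
-- boundaries by at most one vertex; for t > n every block has at most three vertices and any cut works.
module Submission where

open import Defs
open import Data.Bool using (Bool; true; false; if_then_else_)
open import Data.Empty using (⊥; ⊥-elim)
open import Data.Fin using (Fin; zero; suc; toℕ; fromℕ<; quotient; remainder)
open import Data.Fin.Properties
  using (_≟_; toℕ-injective; toℕ-fromℕ<; toℕ<n; toℕ-combine; combine-remQuot)
open import Data.List using (List; []; _∷_; _++_; length; filter; tabulate; replicate)
open import Data.List.Membership.Propositional using (_∈_)
open import Data.List.Membership.Propositional.Properties using (∈-allFin)
open import Data.List.Properties using (filter-none; length-++; length-replicate)
open import Data.List.Relation.Unary.All using (All; []; _∷_)
import Data.List.Relation.Unary.All as All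
open import Data.List.Relation.Unary.All.Properties using (tabulate⁺; ++⁺; replicate⁺)
open import Data.List.Relation.Unary.AllPairs using (_∷_)
open import Data.List.Relation.Unary.Any using (here; there)
open import Data.List.Relation.Unary.Linked using ([-]; _∷_)
open import Data.Nat
  using (ℕ; zero; suc; _+_; _*_; _∸_; _≤_; _<_; _≡ᵇ_; z≤n; s≤s; s≤s⁻¹; _<?_; _≤?_; NonZero; >-nonZero; _/_; _%_)
import Data.Nat as ℕ
open import Data.Nat.DivMod using (m≡m%n+[m/n]*n; m%n<n; m/n*n≤m; m<n*o⇒m/o<n)
open import Data.Nat.ListAction using (sum)
open import Data.Nat.ListAction.Properties using (sum-++)
open import Data.Nat.Properties hiding (_≟_)
open import Data.Nat.Tactic.RingSolver using (solve-∀)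
open import Data.Product using (Σ; _×_; _,_; proj₁; proj₂)
open import Data.Sum using (_⊎_; inj₁; inj₂)
open import Data.Unit using (tt)
open import Function using (_∘_; id)
open import Function.Bundles using (mk⇔)
open import Relation.Binary using (tri<; tri≈; tri>)
open import Relation.Binary.PropositionalEquality
open import Relation.Nullary using (¬_; yes; no; does; contradiction)
open import Relation.Nullary.Decidable using (_×-dec_; does-⇔)
open import Relation.Unary using (Pred; Decidable)

count : (ℕ → Bool) → ℕ → ℕ
count p zero    = 0
count p (suc N) = (if p 0 then 1 else 0) + count (p ∘ suc) N

count-+ : ∀ A B p → count p (A + B) ≡ count p A + count (λ x → p (A + x)) B
count-+ zero    B p = refl
count-+ (suc A) B p = trans (cong (_ +_) (count-+ A B (p ∘ suc)))
                            (sym (+-assoc (if p 0 then 1 else 0) (count (p ∘ suc) A) _))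

count-cong : ∀ N {p p′} → (∀ x → x < N → p x ≡ p′ x) → count p N ≡ count p′ N
count-cong zero    eq = refl
count-cong (suc N) eq =
  cong₂ _+_ (cong (λ b → if b then 1 else 0) (eq 0 (s≤s z≤n)))
            (count-cong N (λ x x<N → eq (suc x) (s≤s x<N)))

count-false : ∀ N → count (λ _ → false) N ≡ 0
count-false zero    = refl
count-false (suc N) = count-false N

count-true : ∀ N → count (λ _ → true) N ≡ N
count-true zero    = refl
count-true (suc N) = cong suc (count-true N)

length-filter-tabulate : ∀ {a ℓ} {A : Set a} {P : Pred A ℓ} (P? : Decidable P) {N} (h : Fin N → A)
  (p : ℕ → Bool) → (∀ j → does (P? (h j)) ≡ p (toℕ j)) → length (filter P? (tabulate h)) ≡ count p N
length-filter-tabulate P? {zero}  h p eq = refl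
length-filter-tabulate P? {suc N} h p eq with does (P? (h zero)) | p 0 | eq zero
... | true  | .true  | refl = cong suc (length-filter-tabulate P? (h ∘ suc) (p ∘ suc) (eq ∘ suc))
... | false | .false | refl = length-filter-tabulate P? (h ∘ suc) (p ∘ suc) (eq ∘ suc)

module _ {a ℓ₁ ℓ₂} {A : Set a} {P : Pred A ℓ₁} {Q : Pred A ℓ₂} (P? : Decidable P) (Q? : Decidable Q)
         (P⊆Q : ∀ {x} → P x → Q x) where

  length-filter-mono : ∀ xs → length (filter P? xs) ≤ length (filter Q? xs)
  length-filter-mono []       = z≤n
  length-filter-mono (x ∷ xs) with P? x | Q? x
  ... | yes _  | yes _  = s≤s (length-filter-mono xs)
  ... | yes px | no ¬qx = contradiction (P⊆Q px) ¬qx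
  ... | no _   | yes _  = m≤n⇒m≤1+n (length-filter-mono xs)
  ... | no _   | no _   = length-filter-mono xs

  length-filter-< : ∀ {x xs} → x ∈ xs → Q x → ¬ P x → length (filter P? xs) < length (filter Q? xs)
  length-filter-< {xs = y ∷ xs} (here refl) qx ¬px with P? y | Q? y
  ... | yes px | _      = contradiction px ¬px
  ... | no _   | yes _  = s≤s (length-filter-mono xs)
  ... | no _   | no ¬qx = contradiction qx ¬qx
  length-filter-< {xs = y ∷ xs} (there x∈xs) qx ¬px with P? y | Q? y
  ... | yes _  | yes _  = s≤s (length-filter-< x∈xs qx ¬px)
  ... | yes py | no ¬qy = contradiction (P⊆Q py) ¬qy
  ... | no _   | yes _  = m≤n⇒m≤1+n (length-filter-< x∈xs qx ¬px)
  ... | no _   | no _   = length-filter-< x∈xs qx ¬px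

module _ (G : Graph) {t : ℕ} (f : Coloring G t) where
  open Graph G using (N; _~_; _~?_; irrefl)

  classDegree<classSize : ∀ v → classDegree G f v < classSize G f (f v)
  classDegree<classSize v =
    length-filter-< (λ u → (u ~? v) ×-dec (f u ≟ f v)) (λ u → f u ≟ f v) proj₂
      (∈-allFin v) refl (irrefl ∘ proj₁)

  classDegree≡0 : ∀ v → (∀ u → f u ≡ f v → ¬ u ~ v) → classDegree G f v ≡ 0
  classDegree≡0 v independent = cong length (filter-none (λ u → (u ~? v) ×-dec (f u ≟ f v))
    (tabulate⁺ λ u (u~v , fu≡fv) → independent u fu≡fv u~v))

  -- a cycle has three consecutive edges x₀x₁, x₁x₂, x₂x₃ with x₁ ≠ x₂, x₀ ≠ x₂, x₁ ≠ x₃,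
  -- and these cannot all pass through one vertex
  acyclic-if-edges-meet : ∀ i (Center : Fin N → Set) → (∀ {u w} → Center u → Center w → u ≡ w) →
    (∀ {u w} → f u ≡ i → f w ≡ i → u ~ w → Center u ⊎ Center w) → ¬ HasCycleIn G f i
  acyclic-if-edges-meet i Center unique meets = λ where
      (v , [] , () , _)
      (v , _ ∷ [] , s≤s () , _)
      (v , w₁ ∷ w₂ ∷ [] , _ , (v≢w₁ ∷ v≢w₂ ∷ []) ∷ (w₁≢w₂ ∷ []) ∷ _ ,
           fv ∷ f₁ ∷ f₂ ∷ [] , a₁ ∷ a₂ ∷ a₃ ∷ [-]) →
        path fv f₁ f₂ fv a₁ a₂ a₃ v≢w₂ w₁≢w₂ (v≢w₁ ∘ sym)
      (v , w₁ ∷ w₂ ∷ w₃ ∷ _ , _ , (_ ∷ v≢w₂ ∷ _) ∷ (w₁≢w₂ ∷ w₁≢w₃ ∷ _) ∷ _ ,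
           fv ∷ f₁ ∷ f₂ ∷ f₃ ∷ _ , a₁ ∷ a₂ ∷ a₃ ∷ _) →
        path fv f₁ f₂ f₃ a₁ a₂ a₃ v≢w₂ w₁≢w₂ w₁≢w₃
    where
    path : ∀ {x₀ x₁ x₂ x₃} → f x₀ ≡ i → f x₁ ≡ i → f x₂ ≡ i → f x₃ ≡ i →
      x₀ ~ x₁ → x₁ ~ x₂ → x₂ ~ x₃ → x₀ ≢ x₂ → x₁ ≢ x₂ → x₁ ≢ x₃ → ⊥
    path f₀ f₁ f₂ f₃ a₀₁ a₁₂ a₂₃ x₀≢x₂ x₁≢x₂ x₁≢x₃ with meets f₁ f₂ a₁₂
    ... | inj₁ c₁ with meets f₂ f₃ a₂₃
    ...   | inj₁ c₂ = x₁≢x₂ (unique c₁ c₂)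
    ...   | inj₂ c₃ = x₁≢x₃ (unique c₁ c₃)
    path f₀ f₁ f₂ f₃ a₀₁ a₁₂ a₂₃ x₀≢x₂ x₁≢x₂ x₁≢x₃ | inj₂ c₂ with meets f₀ f₁ a₀₁
    ...   | inj₁ c₀ = x₀≢x₂ (unique c₀ c₂)
    ...   | inj₂ c₁ = x₁≢x₂ (unique c₁ c₂)

-- Blocks of consecutive vertices of K3 n

InPart : ℕ → ℕ → ℕ → Set
InPart n k x = k * n ≤ x × x < suc k * n

quotient-unique : ∀ n {Q R k} → R < n → InPart n k (n * Q + R) → Q ≡ k
quotient-unique n {Q} {R} {k} R<n (kn≤x , x<[1+k]n) with <-cmp Q k
... | tri≈ _ Q≡k _ = Q≡k
... | tri< Q<k _ _ = contradiction (≤-trans (*-monoˡ-≤ n Q<k) kn≤x) (<⇒≱ x<[1+Q]n)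
  where
  x<[1+Q]n : n * Q + R < suc Q * n
  x<[1+Q]n = subst (n * Q + R <_) (trans (+-comm (n * Q) n) (cong (n +_) (*-comm n Q)))
                   (+-monoʳ-< (n * Q) R<n)
... | tri> _ _ k<Q = contradiction (≤-trans (*-monoˡ-≤ n k<Q) Qn≤x) (<⇒≱ x<[1+k]n)
  where
  Qn≤x : Q * n ≤ n * Q + R
  Qn≤x = subst (_≤ n * Q + R) (*-comm n Q) (m≤m+n (n * Q) R)

toℕ-part : ∀ n {k} (v : Fin (3 * n)) → InPart n k (toℕ v) → toℕ (part n v) ≡ k
toℕ-part n {k} v v∈k = quotient-unique n (toℕ<n (remainder {3} n v))
  (subst (InPart n k) (trans (cong toℕ (sym (combine-remQuot {3} n v))) (toℕ-combine (quotient {3} n v) _)) v∈k)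

samePart : ∀ n {k} {u w : Fin (3 * n)} → InPart n k (toℕ u) → InPart n k (toℕ w) → part n u ≡ part n w
samePart n {k} {u} {w} u∈k w∈k = toℕ-injective (trans (toℕ-part n {k} u u∈k) (sym (toℕ-part n {k} w w∈k)))

-- The block [a, a + b) of vertex positions is good if it lies in one part, or if it has at most
-- four positions, all but possibly c in one part; it then induces a star centered at c.
data GoodBlock (n a b : ℕ) : Set where
  inPart : ∀ k → k * n ≤ a → a + b ≤ suc k * n → GoodBlock n a b
  star   : b ≤ 4 → ∀ c k → (∀ x → a ≤ x → x < a + b → x ≢ c → InPart n k x) → GoodBlock n a b

module _ {n t} (f : Coloring (K3 n) t) (i : Fin t) {a b : ℕ}
         (member : ∀ v → f v ≡ i → a ≤ toℕ v × toℕ v < a + b) where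

  private
    inside : ∀ k {v} → k * n ≤ a → a + b ≤ suc k * n → f v ≡ i → InPart n k (toℕ v)
    inside k kn≤a a+b≤ fv≡i with member _ fv≡i
    ... | a≤v , v<a+b = ≤-trans kn≤a a≤v , <-≤-trans v<a+b a+b≤

  goodBlock-acyclic : GoodBlock n a b → ¬ HasCycleIn (K3 n) f i
  goodBlock-acyclic (inPart k kn≤a a+b≤) =
    acyclic-if-edges-meet (K3 n) f i (λ _ → ⊥) (λ ())
      λ fu fw u~w → ⊥-elim (u~w (samePart n {k} (inside k kn≤a a+b≤ fu) (inside k kn≤a a+b≤ fw)))
  goodBlock-acyclic (star _ c k leaf) =
    acyclic-if-edges-meet (K3 n) f i (λ u → toℕ u ≡ c) (λ p q → toℕ-injective (trans p (sym q))) meets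
    where
    inLeafPart : ∀ {u} → f u ≡ i → toℕ u ≢ c → InPart n k (toℕ u)
    inLeafPart fu u≢c with member _ fu
    ... | a≤u , u<a+b = leaf _ a≤u u<a+b u≢c
    meets : ∀ {u w} → f u ≡ i → f w ≡ i → ¬ part n u ≡ part n w → toℕ u ≡ c ⊎ toℕ w ≡ c
    meets {u} {w} fu fw u~w with toℕ u ℕ.≟ c | toℕ w ℕ.≟ c
    ... | yes u≡c | _       = inj₁ u≡c
    ... | no _    | yes w≡c = inj₂ w≡c
    ... | no u≢c  | no w≢c  = ⊥-elim (u~w (samePart n {k} (inLeafPart fu u≢c) (inLeafPart fw w≢c)))

  goodBlock-degree : GoodBlock n a b → classSize (K3 n) f i ≡ b →
    ∀ v → f v ≡ i → classDegree (K3 n) f v ≤ 3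
  goodBlock-degree (inPart k kn≤a a+b≤) _ v fv =
    ≤-trans (≤-reflexive (classDegree≡0 (K3 n) f v λ u fu≡fv u~v →
      u~v (samePart n {k} (inside k kn≤a a+b≤ (trans fu≡fv fv)) (inside k kn≤a a+b≤ fv)))) z≤n
  goodBlock-degree (star b≤4 _ _ _) size≡b v fv = s≤s⁻¹ (begin-strict
    classDegree (K3 n) f v    <⟨ classDegree<classSize (K3 n) f v ⟩
    classSize (K3 n) f (f v)  ≡⟨ cong (classSize (K3 n) f) fv ⟩
    classSize (K3 n) f i      ≡⟨ size≡b ⟩
    b                         ≤⟨ b≤4 ⟩
    4                         ∎)
    where open ≤-Reasoning

-- Layouts

-- A layout L splits the positions 0 … sum L − 1 into consecutive blocks of the sizes listed in L.
blockIndex : List ℕ → ℕ → ℕ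
blockIndex []      x = 0
blockIndex (b ∷ L) x with x <? b
... | yes _ = 0
... | no _  = suc (blockIndex L (x ∸ b))

blockStart : List ℕ → ℕ → ℕ
blockStart []      _       = 0
blockStart (b ∷ L) zero    = 0
blockStart (b ∷ L) (suc i) = b + blockStart L i

blockSize : List ℕ → ℕ → ℕ
blockSize []      _       = 0
blockSize (b ∷ L) zero    = b
blockSize (b ∷ L) (suc i) = blockSize L i

InBlock : List ℕ → ℕ → ℕ → Set
InBlock L i x = blockStart L i ≤ x × x < blockStart L i + blockSize L i

blockIndex-< : ∀ {b} L {x} → x < b → blockIndex (b ∷ L) x ≡ 0
blockIndex-< {b} L {x} x<b with x <? b
... | yes _   = refl
... | no x≮b = contradiction x<b x≮b

blockIndex-+ : ∀ b L y → blockIndex (b ∷ L) (b + y) ≡ suc (blockIndex L y)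
blockIndex-+ b L y with b + y <? b
... | yes b+y<b = contradiction b+y<b (m+n≮m b y)
... | no _      = cong (suc ∘ blockIndex L) (m+n∸m≡n b y)

data FirstBlockView (b : ℕ) : ℕ → Set where
  first : ∀ {x} → x < b → FirstBlockView b x
  later : ∀ y → FirstBlockView b (b + y)

firstBlockView : ∀ b x → FirstBlockView b x
firstBlockView b x with x <? b
... | yes x<b = first x<b
... | no x≮b with m≤n⇒∃[o]m+o≡n (≮⇒≥ x≮b)
...   | y , refl = later y

blockIndex<length : ∀ L {x} → x < sum L → blockIndex L x < length L
blockIndex<length (b ∷ L) {x} x<sum with firstBlockView b x
... | first x<b rewrite blockIndex-< L x<b = s≤s z≤n
... | later y   rewrite blockIndex-+ b L y =
  s≤s (blockIndex<length L (+-cancelˡ-< b y (sum L) x<sum))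

blockIndex-inBlock : ∀ L {x} → x < sum L → InBlock L (blockIndex L x) x
blockIndex-inBlock (b ∷ L) {x} x<sum with firstBlockView b x
... | first x<b rewrite blockIndex-< L x<b = z≤n , x<b
... | later y   rewrite blockIndex-+ b L y with blockIndex-inBlock L (+-cancelˡ-< b y (sum L) x<sum)
...   | start≤y , y<end =
  +-monoʳ-≤ b start≤y , subst (b + y <_) (sym (+-assoc b _ _)) (+-monoʳ-< b y<end)

count-blockIndex : ∀ L i → count (λ x → blockIndex L x ≡ᵇ i) (sum L) ≡ blockSize L i
count-blockIndex []      i = refl
count-blockIndex (b ∷ L) i = begin
    count (λ x → blockIndex (b ∷ L) x ≡ᵇ i) (b + sum L)
  ≡⟨ count-+ b (sum L) _ ⟩
    count (λ x → blockIndex (b ∷ L) x ≡ᵇ i) b + count (λ y → blockIndex (b ∷ L) (b + y) ≡ᵇ i) (sum L)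
  ≡⟨ cong₂ _+_ (count-cong b λ _ x<b → cong (_≡ᵇ i) (blockIndex-< L x<b))
               (count-cong (sum L) λ y _ → cong (_≡ᵇ i) (blockIndex-+ b L y)) ⟩
    count (λ _ → 0 ≡ᵇ i) b + count (λ y → suc (blockIndex L y) ≡ᵇ i) (sum L)
  ≡⟨ split i ⟩
    blockSize (b ∷ L) i ∎
  where
  open ≡-Reasoning
  split : ∀ i → count (λ _ → 0 ≡ᵇ i) b + count (λ y → suc (blockIndex L y) ≡ᵇ i) (sum L)
                ≡ blockSize (b ∷ L) i
  split zero    = trans (cong₂ _+_ (count-true b) (count-false (sum L))) (+-identityʳ b)
  split (suc i) = trans (cong (_+ _) (count-false b)) (count-blockIndex L i)

All-blockSize : ∀ {P : ℕ → Set} {L i} → All P L → i < length L → P (blockSize L i)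
All-blockSize {i = zero}  (p ∷ _)  _          = p
All-blockSize {i = suc i} (_ ∷ ps) (s≤s i<ℓ) = All-blockSize ps i<ℓ

data GoodLayout (n : ℕ) : ℕ → List ℕ → Set where
  []  : ∀ {s} → GoodLayout n s []
  _∷_ : ∀ {s b L} → GoodBlock n s b → GoodLayout n (s + b) L → GoodLayout n s (b ∷ L)

goodLayout-block : ∀ {n s L} → GoodLayout n s L → ∀ {i} → i < length L →
  GoodBlock n (s + blockStart L i) (blockSize L i)
goodLayout-block {n} {s} (_∷_ {b = b} g _) {zero} _ =
  subst (λ a → GoodBlock n a b) (sym (+-identityʳ s)) g
goodLayout-block {n} {s} (_∷_ {b = b} {L} _ gs) {suc i} (s≤s i<ℓ) =
  subst (λ a → GoodBlock n a (blockSize L i)) (+-assoc s b _) (goodLayout-block gs i<ℓ)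

Balanced : ℕ → List ℕ → Set
Balanced q = All (λ b → q ≤ b × b ≤ suc q)

balanced⇒≤ : ∀ {q L} → Balanced q L → All (_≤ suc q) L
balanced⇒≤ = All.map proj₂

EquitableTreeColorable : ℕ → ℕ → Set
EquitableTreeColorable n t = Σ (Coloring (K3 n) t) (EquitableTreeColoring (K3 n) t 3)

layoutColoring : ∀ {n t q} L → length L ≡ t → sum L ≡ 3 * n → Balanced q L → GoodLayout n 0 L →
  EquitableTreeColorable n t
layoutColoring {n} {t} {q} L length≡t sum≡3n balanced good =
  color , ((λ i → goodBlock-acyclic color i (member i) (goodBlock i)) ,
            (λ v → goodBlock-degree color (color v) (member (color v)) (goodBlock (color v))
                     (classSize-color (color v)) v refl)) ,
  equitable
  where
  pos<sum : (v : Fin (3 * n)) → toℕ v < sum L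
  pos<sum v = subst (toℕ v <_) (sym sum≡3n) (toℕ<n v)

  index<t : (v : Fin (3 * n)) → blockIndex L (toℕ v) < t
  index<t v = subst (_ <_) length≡t (blockIndex<length L (pos<sum v))

  color : Coloring (K3 n) t
  color v = fromℕ< (index<t v)

  i<length : (i : Fin t) → toℕ i < length L
  i<length i = subst (toℕ i <_) (sym length≡t) (toℕ<n i)

  goodBlock : (i : Fin t) → GoodBlock n (blockStart L (toℕ i)) (blockSize L (toℕ i))
  goodBlock i = goodLayout-block good (i<length i)

  member : ∀ i v → color v ≡ i → InBlock L (toℕ i) (toℕ v)
  member i v refl =
    subst (λ j → InBlock L j (toℕ v)) (sym (toℕ-fromℕ< (index<t v))) (blockIndex-inBlock L (pos<sum v))

  classSize-color : ∀ i → classSize (K3 n) color i ≡ blockSize L (toℕ i)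
  classSize-color i = begin
      classSize (K3 n) color i
    ≡⟨ length-filter-tabulate (λ v → color v ≟ i) id (λ x → blockIndex L x ≡ᵇ toℕ i)
         (λ v → trans (does-⇔ (mk⇔ (cong toℕ) toℕ-injective) (color v ≟ i) (toℕ (color v) ℕ.≟ toℕ i))
                      (cong (_≡ᵇ toℕ i) (toℕ-fromℕ< (index<t v)))) ⟩
      count (λ x → blockIndex L x ≡ᵇ toℕ i) (3 * n)
    ≡⟨ cong (count _) (sym sum≡3n) ⟩
      count (λ x → blockIndex L x ≡ᵇ toℕ i) (sum L)
    ≡⟨ count-blockIndex L (toℕ i) ⟩
      blockSize L (toℕ i) ∎
    where open ≡-Reasoning

  equitable : Equitable (K3 n) color
  equitable i j with All-blockSize balanced (i<length i) | All-blockSize balanced (i<length j)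
  ... | _ , sᵢ≤1+q | q≤sⱼ , _ rewrite classSize-color i | classSize-color j =
    ≤-trans sᵢ≤1+q (subst (suc q ≤_) (+-comm 1 (blockSize L (toℕ j))) (s≤s q≤sⱼ))

goodLayout-within : ∀ {n lo hi} {P : ℕ → Set} → (∀ {a b} → lo ≤ a → a + b ≤ hi → P b → GoodBlock n a b) →
  ∀ {s L} → All P L → lo ≤ s → s + sum L ≤ hi → GoodLayout n s L
goodLayout-within good []       _    _      = []
goodLayout-within {hi = hi} good {s} {b ∷ L} (p ∷ ps) lo≤s end≤hi =
  good lo≤s (≤-trans (m≤m+n (s + b) (sum L)) end≤hi′) p ∷
  goodLayout-within good ps (≤-trans lo≤s (m≤m+n s b)) end≤hi′
  where
  end≤hi′ : s + b + sum L ≤ hi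
  end≤hi′ = subst (_≤ hi) (sym (+-assoc s b (sum L))) end≤hi

goodLayout-++ : ∀ {n s A B} → GoodLayout n s A → GoodLayout n (s + sum A) B → GoodLayout n s (A ++ B)
goodLayout-++ {n} {s} {B = B} [] gB = subst (λ s′ → GoodLayout n s′ B) (+-identityʳ s) gB
goodLayout-++ {n} {s} {B = B} (_∷_ {b = b} {L} g gA) gB =
  g ∷ goodLayout-++ gA (subst (λ s′ → GoodLayout n s′ B) (sym (+-assoc s b (sum L))) gB)

goodLayout-inPart : ∀ {n} k {s L} → k * n ≤ s → s + sum L ≤ suc k * n → GoodLayout n s L
goodLayout-inPart k {L = L} =
  goodLayout-within (λ kn≤a a+b≤ _ → inPart k kn≤a a+b≤) (All.universal (λ _ → tt) L)

goodBlock-near : ∀ {n k a b} → 3 ≤ n → b ≤ 4 → k * n ≤ suc a → a + b ≤ suc (suc k * n) → GoodBlock n a b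
goodBlock-near {n} {k} {a} {b} 3≤n b≤4 kn≤1+a a+b≤ with k * n ≤? a | a + b ≤? suc k * n
... | yes kn≤a | yes a+b≤′ = inPart k kn≤a a+b≤′
... | yes kn≤a | no _      = star b≤4 (suc k * n) k λ x a≤x x<a+b x≢c →
  ≤-trans kn≤a a≤x , ≤∧≢⇒< (s≤s⁻¹ (≤-trans x<a+b a+b≤)) x≢c
... | no kn≰a  | _         = star b≤4 a k λ x a≤x x<a+b x≢a →
  let kn≡1+a = ≤-antisym kn≤1+a (≰⇒> kn≰a) in
  subst (_≤ x) (sym kn≡1+a) (≤∧≢⇒< a≤x (x≢a ∘ sym)) ,
  (begin-strict
    x             <⟨ x<a+b ⟩
    a + b         ≤⟨ +-monoʳ-≤ a b≤4 ⟩
    a + 4         ≡⟨ +-comm a 4 ⟩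
    3 + suc a     ≡⟨ cong (3 +_) (sym kn≡1+a) ⟩
    3 + k * n     ≤⟨ +-monoˡ-≤ (k * n) 3≤n ⟩
    suc k * n     ∎)
  where open ≤-Reasoning

below-next-multiple : ∀ m n .{{_ : NonZero n}} → m < suc (m / n) * n
below-next-multiple m n =
  subst (_< suc (m / n) * n) (sym (m≡m%n+[m/n]*n m n)) (+-monoˡ-< (m / n * n) (m%n<n m n))

goodBlock-small : ∀ {n a b} → 3 ≤ n → b ≤ 3 → GoodBlock n a b
goodBlock-small {n} {a} {b} 3≤n b≤3 =
  goodBlock-near {k = suc a / n} 3≤n (m≤n⇒m≤1+n b≤3) (m/n*n≤m (suc a) n)
    (≤-trans (+-monoʳ-≤ a b≤3) a+3≤)
  where
  instance
    _ : NonZero n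
    _ = >-nonZero (≤-trans (s≤s z≤n) 3≤n)
  a+3≤ : a + 3 ≤ suc (suc (suc a / n) * n)
  a+3≤ = subst (_≤ suc (suc (suc a / n) * n)) (+-comm 3 a) (s≤s (below-next-multiple (suc a) n))

goodLayout₃ : ∀ {n L₀ L₁ L₂} → GoodLayout n 0 L₀ → GoodLayout n (sum L₀) L₁ →
  GoodLayout n (sum L₀ + sum L₁) L₂ → GoodLayout n 0 (L₀ ++ L₁ ++ L₂)
goodLayout₃ g₀ g₁ g₂ = goodLayout-++ g₀ (goodLayout-++ g₁ g₂)

goodLayout-aligned : ∀ {n L₀ L₁ L₂} → sum L₀ ≡ n → sum L₁ ≡ n → sum L₂ ≡ n →
  GoodLayout n 0 (L₀ ++ L₁ ++ L₂)
goodLayout-aligned {n} {L₀} {L₁} {L₂} s₀ s₁ s₂ = goodLayout₃ {L₀ = L₀} {L₁} {L₂}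
  (goodLayout-inPart 0 z≤n (≤-reflexive (trans s₀ (sym (+-identityʳ n)))))
  (goodLayout-inPart 1 (≤-reflexive (trans (+-identityʳ n) (sym s₀))) (≤-reflexive s₀₁))
  (goodLayout-inPart 2 (≤-reflexive (sym s₀₁)) (≤-reflexive (trans (cong₂ _+_ s₀₁ s₂) (+-comm (2 * n) n))))
  where
  s₀₁ : sum L₀ + sum L₁ ≡ 2 * n
  s₀₁ = trans (cong₂ _+_ s₀ s₁) (cong (n +_) (sym (+-identityʳ n)))

infix 4 _≈₁_
_≈₁_ : ℕ → ℕ → Set
m ≈₁ n = m ≤ suc n × n ≤ suc m

≈₁-pred : ∀ {m n} → suc m ≡ n → m ≈₁ n
≈₁-pred {m} refl = m≤n⇒m≤1+n (n≤1+n m) , ≤-refl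

≈₁-suc : ∀ {m n} → m ≡ suc n → m ≈₁ n
≈₁-suc {n = n} refl = ≤-refl , m≤n⇒m≤1+n (n≤1+n n)

goodLayout-nearPart : ∀ {n} → 3 ≤ n → ∀ k {s L} → All (_≤ 4) L →
  k * n ≤ suc s → s + sum L ≤ suc (suc k * n) → GoodLayout n s L
goodLayout-nearPart 3≤n k small kn≤1+s end≤ = goodLayout-within
  (λ s≤a a+b≤ b≤4 → goodBlock-near {k = k} 3≤n b≤4 (≤-trans kn≤1+s (s≤s s≤a)) a+b≤) small ≤-refl end≤

goodLayout-near : ∀ {n L₀ L₁ L₂} → 3 ≤ n → All (_≤ 4) L₀ → All (_≤ 4) L₁ → All (_≤ 4) L₂ →
  sum L₀ ≈₁ 1 * n → sum L₀ + sum L₁ ≈₁ 2 * n → sum L₀ + (sum L₁ + sum L₂) ≡ 3 * n →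
  GoodLayout n 0 (L₀ ++ L₁ ++ L₂)
goodLayout-near {L₀ = L₀} {L₁} {L₂} 3≤n small₀ small₁ small₂ (s₀≤ , ≤s₀) (s₀₁≤ , ≤s₀₁) s₀₁₂ =
  goodLayout₃ {L₀ = L₀} {L₁} {L₂}
  (goodLayout-nearPart 3≤n 0 small₀ z≤n s₀≤)
  (goodLayout-nearPart 3≤n 1 small₁ ≤s₀ s₀₁≤)
  (goodLayout-nearPart 3≤n 2 small₂ ≤s₀₁
    (≤-trans (≤-reflexive (trans (+-assoc (sum L₀) _ _) s₀₁₂)) (n≤1+n _)))

-- Colorings for each range of t

sum-replicate : ∀ c b → sum (replicate c b) ≡ c * b
sum-replicate zero    b = refl
sum-replicate (suc c) b = cong (b +_) (sum-replicate c b)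

length-++₃ : ∀ {A : Set} (L₀ L₁ L₂ : List A) →
  length (L₀ ++ L₁ ++ L₂) ≡ length L₀ + (length L₁ + length L₂)
length-++₃ L₀ L₁ L₂ = trans (length-++ L₀) (cong (length L₀ +_) (length-++ L₁))

sum-++₃ : ∀ L₀ L₁ L₂ → sum (L₀ ++ L₁ ++ L₂) ≡ sum L₀ + (sum L₁ + sum L₂)
sum-++₃ L₀ L₁ L₂ = trans (sum-++ L₀ _) (cong (sum L₀ +_) (sum-++ L₁ L₂))

segmentsColoring : ∀ {n t q} L₀ L₁ L₂ → length L₀ + (length L₁ + length L₂) ≡ t →
  sum L₀ + (sum L₁ + sum L₂) ≡ 3 * n → Balanced q L₀ → Balanced q L₁ → Balanced q L₂ →
  GoodLayout n 0 (L₀ ++ L₁ ++ L₂) → EquitableTreeColorable n t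
segmentsColoring L₀ L₁ L₂ length≡t sum≡3n balanced₀ balanced₁ balanced₂ =
  layoutColoring (L₀ ++ L₁ ++ L₂) (trans (length-++₃ L₀ L₁ L₂) length≡t)
    (trans (sum-++₃ L₀ L₁ L₂) sum≡3n) (++⁺ balanced₀ (++⁺ balanced₁ balanced₂))

Partition : ℕ → ℕ → ℕ → Set
Partition q c N = Σ (List ℕ) λ L → length L ≡ c × sum L ≡ N × Balanced q L

-- take N − q c blocks of size q + 1 and the remaining ones of size q
evenPartition : ∀ q c N → q * c ≤ N → N ≤ suc q * c → Partition q c N
evenPartition q c N qc≤N N≤[1+q]c with m≤n⇒∃[o]m+o≡n qc≤N
... | F , refl with m≤n⇒∃[o]m+o≡n (+-cancelˡ-≤ (q * c) F c (subst (q * c + F ≤_) (+-comm c (q * c)) N≤[1+q]c))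
...   | T , refl =
  replicate F (suc q) ++ replicate T q ,
  trans (length-++ (replicate F (suc q))) (cong₂ _+_ (length-replicate F) (length-replicate T)) ,
  trans (sum-++ (replicate F (suc q)) _)
        (trans (cong₂ _+_ (sum-replicate F (suc q)) (sum-replicate T q)) (sizes F T q)) ,
  ++⁺ (replicate⁺ F (n≤1+n q , ≤-refl)) (replicate⁺ T (≤-refl , n≤1+n q))
  where
  sizes : ∀ F T q → F * suc q + T * q ≡ q * (F + T) + F
  sizes = solve-∀

Between : ℕ → ℕ → ℕ → Set
Between a b c = a ≤ c × c ≤ b

Split₃ : ℕ → ℕ → ℕ → Set
Split₃ a b t = Σ ℕ λ c₀ → Σ ℕ λ c₁ → Σ ℕ λ c₂ →
  Between a b c₀ × Between a b c₁ × Between a b c₂ × c₀ + (c₁ + c₂) ≡ t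

-- t = r + 3 c with r < 3 is split as (c + [r > 0]) + (c + [r > 1]) + c
split₃ : ∀ {a b t} → 3 * a ≤ t → t ≤ 3 * b → Split₃ a b t
split₃ {a} {b} {t} 3a≤t t≤3b = parts (t % 3) (m%n<n t 3) (m≡m%n+[m/n]*n t 3)
  where
  c = t / 3

  a≤c : ∀ {r} → r < 3 → t ≡ r + c * 3 → a ≤ c
  a≤c {r} r<3 t≡ = s≤s⁻¹ (*-cancelˡ-< 3 a (suc c) (begin-strict
    3 * a      ≤⟨ 3a≤t ⟩
    t          ≡⟨ t≡ ⟩
    r + c * 3  <⟨ +-monoˡ-< (c * 3) r<3 ⟩
    suc c * 3  ≡⟨ *-comm (suc c) 3 ⟩
    3 * suc c  ∎))
    where open ≤-Reasoning

  c≤b : ∀ {r} → t ≡ r + c * 3 → c ≤ b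
  c≤b {r} t≡ = *-cancelˡ-≤ 3 (begin
    3 * c      ≡⟨ *-comm 3 c ⟩
    c * 3      ≤⟨ m≤n+m (c * 3) r ⟩
    r + c * 3  ≡⟨ t≡ ⟨
    t          ≤⟨ t≤3b ⟩
    3 * b      ∎)
    where open ≤-Reasoning

  c<b : ∀ {r} → 0 < r → t ≡ r + c * 3 → c < b
  c<b {r} 0<r t≡ = *-cancelˡ-< 3 c b (begin-strict
    3 * c      ≡⟨ *-comm 3 c ⟩
    c * 3      <⟨ m<n+m (c * 3) 0<r ⟩
    r + c * 3  ≡⟨ t≡ ⟨
    t          ≤⟨ t≤3b ⟩
    3 * b      ∎)
    where open ≤-Reasoning

  parts : ∀ r → r < 3 → t ≡ r + c * 3 → Split₃ a b t
  parts 0 r<3 t≡ = c , c , c , (lo , hi) , (lo , hi) , (lo , hi) , trans (sum₀ c) (sym t≡)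
    where
    lo = a≤c r<3 t≡
    hi = c≤b t≡
    sum₀ : ∀ c → c + (c + c) ≡ 0 + c * 3
    sum₀ = solve-∀
  parts 1 r<3 t≡ = suc c , c , c , (m≤n⇒m≤1+n lo , c<b (s≤s z≤n) t≡) , (lo , hi) , (lo , hi) ,
                   trans (sum₁ c) (sym t≡)
    where
    lo = a≤c r<3 t≡
    hi = c≤b t≡
    sum₁ : ∀ c → suc c + (c + c) ≡ 1 + c * 3
    sum₁ = solve-∀
  parts 2 r<3 t≡ = suc c , suc c , c , (m≤n⇒m≤1+n lo , up) , (m≤n⇒m≤1+n lo , up) , (lo , c≤b t≡) ,
                   trans (sum₂ c) (sym t≡)
    where
    lo = a≤c r<3 t≡
    up = c<b (s≤s z≤n) t≡
    sum₂ : ∀ c → suc c + (suc c + c) ≡ 2 + c * 3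
    sum₂ = solve-∀
  parts (suc (suc (suc _))) (s≤s (s≤s (s≤s ()))) _

alignedColoring : ∀ {n t} q a b → q * b ≤ n → n ≤ suc q * a → 3 * a ≤ t → t ≤ 3 * b →
  EquitableTreeColorable n t
alignedColoring {n} {t} q a b qb≤n n≤[1+q]a 3a≤t t≤3b =
  let c₀ , c₁ , c₂ , c₀∈ , c₁∈ , c₂∈ , Σc≡t = split₃ 3a≤t t≤3b
      L₀ , len₀ , sum₀ , bal₀ = partPartition c₀∈
      L₁ , len₁ , sum₁ , bal₁ = partPartition c₁∈
      L₂ , len₂ , sum₂ , bal₂ = partPartition c₂∈
  in segmentsColoring L₀ L₁ L₂ (trans (cong₂ _+_ len₀ (cong₂ _+_ len₁ len₂)) Σc≡t)
       (trans (cong₂ _+_ sum₀ (cong₂ _+_ sum₁ sum₂)) (cong (λ m → n + (n + m)) (sym (+-identityʳ n))))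
       bal₀ bal₁ bal₂ (goodLayout-aligned {L₀ = L₀} {L₁} {L₂} sum₀ sum₁ sum₂)
  where
  partPartition : ∀ {c} → Between a b c → Partition q c n
  partPartition {c} (a≤c , c≤b) =
    evenPartition q c n (≤-trans (*-monoʳ-≤ q c≤b) qb≤n) (≤-trans n≤[1+q]a (*-monoʳ-≤ (suc q) a≤c))

smallColoring : ∀ {n t} → 3 ≤ n → n < t → EquitableTreeColorable n t
smallColoring {n} {t} 3≤n n<t =
  let L , length≡t , sum≡3n , balanced =
        evenPartition q t (3 * n) (m/n*n≤m (3 * n) t) (<⇒≤ (below-next-multiple (3 * n) t))
  in layoutColoring L length≡t sum≡3n balanced
       (goodLayout-within (λ _ _ b≤3 → goodBlock-small 3≤n b≤3)
         (All.map (λ b≤1+q → ≤-trans b≤1+q q<3) (balanced⇒≤ balanced)) z≤n (≤-reflexive sum≡3n))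
  where
  instance
    _ : NonZero t
    _ = >-nonZero (≤-trans (s≤s z≤n) n<t)
  q = 3 * n / t
  q<3 : q < 3
  q<3 = m<n*o⇒m/o<n (*-monoʳ-< 3 n<t)

-- n = ρ + sum S and t = ρ + 3 length S: the ρ extra vertices go into ρ extra blocks of size 3,
-- which moves the segment boundaries off the part boundaries by one position
nearColoring-split : ∀ {n t} (S : List ℕ) → 3 ≤ n → Balanced 3 S →
  ∀ ρ → ρ < 3 → n ≡ ρ + sum S → t ≡ ρ + 3 * length S → EquitableTreeColorable n t
nearColoring-split S _ bal 0 _ refl refl =
  segmentsColoring S S S (triple (length S)) (triple (sum S)) bal bal bal
    (goodLayout-aligned {L₀ = S} {S} {S} refl refl refl)
  where
  triple : ∀ x → x + (x + x) ≡ 3 * x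
  triple = solve-∀
nearColoring-split S 3≤n bal 1 _ refl refl =
  segmentsColoring S (3 ∷ S) S (lengths (length S)) (sums (sum S)) bal bal⁺ bal
    (goodLayout-near {L₀ = S} {3 ∷ S} {S} 3≤n (balanced⇒≤ bal) (balanced⇒≤ bal⁺) (balanced⇒≤ bal)
      (≈₁-pred (sym (*-identityˡ _))) (≈₁-suc (boundary₂ (sum S))) (sums (sum S)))
  where
  bal⁺ : Balanced 3 (3 ∷ S)
  bal⁺ = (≤-refl , n≤1+n 3) ∷ bal
  lengths : ∀ ℓ → ℓ + (suc ℓ + ℓ) ≡ 1 + 3 * ℓ
  lengths = solve-∀
  sums : ∀ σ → σ + ((3 + σ) + σ) ≡ 3 * (1 + σ)
  sums = solve-∀
  boundary₂ : ∀ σ → σ + (3 + σ) ≡ suc (2 * suc σ)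
  boundary₂ = solve-∀
nearColoring-split S 3≤n bal 2 _ refl refl =
  segmentsColoring (3 ∷ S) S (3 ∷ S) (lengths (length S)) (sums (sum S)) bal⁺ bal bal⁺
    (goodLayout-near {L₀ = 3 ∷ S} {S} {3 ∷ S} 3≤n (balanced⇒≤ bal⁺) (balanced⇒≤ bal) (balanced⇒≤ bal⁺)
      (≈₁-suc (cong suc (sym (*-identityˡ _)))) (≈₁-pred (boundary₂ (sum S))) (sums (sum S)))
  where
  bal⁺ : Balanced 3 (3 ∷ S)
  bal⁺ = (≤-refl , n≤1+n 3) ∷ bal
  lengths : ∀ ℓ → suc ℓ + (ℓ + suc ℓ) ≡ 2 + 3 * ℓ
  lengths = solve-∀
  sums : ∀ σ → (3 + σ) + (σ + (3 + σ)) ≡ 3 * (2 + σ)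
  sums = solve-∀
  boundary₂ : ∀ σ → suc ((3 + σ) + σ) ≡ 2 * (2 + σ)
  boundary₂ = solve-∀
nearColoring-split S _ _ (suc (suc (suc _))) (s≤s (s≤s (s≤s ()))) _ _

nearColoring : ∀ {n t} → 3 ≤ n → 3 * n ≤ 4 * t → t ≤ n → EquitableTreeColorable n t
nearColoring {n} {t} 3≤n 3n≤4t t≤n = withSlack (m≤n⇒∃[o]m+o≡n (≤-trans ρ≤t t≤n))
  where
  ρ = t % 3
  ℓ = t / 3
  t≡ρ+3ℓ : t ≡ ρ + 3 * ℓ
  t≡ρ+3ℓ = trans (m≡m%n+[m/n]*n t 3) (cong (ρ +_) (*-comm ℓ 3))
  ρ≤t : ρ ≤ t
  ρ≤t = subst (ρ ≤_) (sym t≡ρ+3ℓ) (m≤m+n ρ (3 * ℓ))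

  withSlack : Σ ℕ (λ σ → ρ + σ ≡ n) → EquitableTreeColorable n t
  withSlack (σ , ρ+σ≡n) =
    let S , length≡ℓ , sum≡σ , balanced = evenPartition 3 ℓ σ 3ℓ≤σ σ≤4ℓ in
    nearColoring-split S 3≤n balanced ρ (m%n<n t 3)
      (trans (sym ρ+σ≡n) (cong (ρ +_) (sym sum≡σ)))
      (trans t≡ρ+3ℓ (cong (λ x → ρ + 3 * x) (sym length≡ℓ)))
    where
    3ℓ≤σ : 3 * ℓ ≤ σ
    3ℓ≤σ = +-cancelˡ-≤ ρ (3 * ℓ) σ (subst₂ _≤_ t≡ρ+3ℓ (sym ρ+σ≡n) t≤n)
    σ≤4ℓ : σ ≤ 4 * ℓ
    σ≤4ℓ = +-cancelˡ-≤ ρ σ (4 * ℓ) (s≤s⁻¹ (*-cancelˡ-< 3 (ρ + σ) (suc (ρ + 4 * ℓ)) (begin-strict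
      3 * (ρ + σ)              ≡⟨ cong (3 *_) ρ+σ≡n ⟩
      3 * n                    ≤⟨ 3n≤4t ⟩
      4 * t                    ≡⟨ cong (4 *_) t≡ρ+3ℓ ⟩
      4 * (ρ + 3 * ℓ)          ≡⟨ regroup ρ ℓ ⟩
      3 * (ρ + 4 * ℓ) + ρ      <⟨ +-monoʳ-< (3 * (ρ + 4 * ℓ)) (m%n<n t 3) ⟩
      3 * (ρ + 4 * ℓ) + 3      ≡⟨ +-comm (3 * (ρ + 4 * ℓ)) 3 ⟩
      3 + 3 * (ρ + 4 * ℓ)      ≡⟨ *-suc 3 (ρ + 4 * ℓ) ⟨
      3 * suc (ρ + 4 * ℓ)      ∎)))
      where
      open ≤-Reasoning
      regroup : ∀ ρ ℓ → 4 * (ρ + 3 * ℓ) ≡ 3 * (ρ + 4 * ℓ) + ρ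
      regroup = solve-∀

lemma17 : (m : ℕ) → 2 ≤ m → let k = 5 * m + 1 in
    StrongEqVertexArboricity≤ (K3 (4 * k + 1)) 3 (12 * m)
lemma17 m 2≤m = colorable
  where
  n = 4 * (5 * m + 1) + 1

  n≡5+20m : ∀ m → 4 * (5 * m + 1) + 1 ≡ 5 + 5 * (4 * m)
  n≡5+20m = solve-∀
  5[4m+1]≡n : ∀ m → 5 * (4 * m + 1) ≡ 4 * (5 * m + 1) + 1
  5[4m+1]≡n = solve-∀
  1+3n≡4[15m+4] : ∀ m → suc (3 * (4 * (5 * m + 1) + 1)) ≡ 4 * suc (3 * (5 * m + 1))
  1+3n≡4[15m+4] = solve-∀

  3≤n : 3 ≤ n
  3≤n = ≤-trans (m≤m+n 3 (2 + 5 * (4 * m))) (≤-reflexive (sym (n≡5+20m m)))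

  n≤6[4m] : n ≤ 6 * (4 * m)
  n≤6[4m] = ≤-trans (≤-reflexive (n≡5+20m m))
                    (+-monoˡ-≤ (5 * (4 * m)) (≤-trans (m≤m+n 5 3) (*-monoʳ-≤ 4 2≤m)))

  colorable : ∀ t → 12 * m ≤ t → EquitableTreeColorable n t
  colorable t 12m≤t with t ≤? 3 * (4 * m + 1)
  ... | yes t≤12m+3 =
    alignedColoring 5 (4 * m) (4 * m + 1) (≤-reflexive (5[4m+1]≡n m)) n≤6[4m]
      (≤-trans (≤-reflexive (sym (*-assoc 3 4 m))) 12m≤t) t≤12m+3
  ... | no t≰12m+3 with t ≤? 3 * (5 * m + 1)
  ...   | yes t≤15m+3 =
    alignedColoring 4 (4 * m + 1) (5 * m + 1) (m≤m+n _ 1) (≤-reflexive (sym (5[4m+1]≡n m)))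
      (<⇒≤ (≰⇒> t≰12m+3)) t≤15m+3
  ...   | no t≰15m+3 with t ≤? n
  ...     | yes t≤n = nearColoring 3≤n
    (≤-trans (n≤1+n (3 * n)) (≤-trans (≤-reflexive (1+3n≡4[15m+4] m)) (*-monoʳ-≤ 4 (≰⇒> t≰15m+3)))) t≤n
  ...     | no t≰n = smallColoring 3≤n (≰⇒> t≰n)
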